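{- Let $p\ge 5$ be a prime and $z$ a variable, and put $N=\lfloor p/3\rfloor$. Then, as polynomials in $z$ with coefficients in $\mathbb{Z}_{(p)}$, $$\sum_{k=1}^{N}(-1)^k\binom{N}{k}\binom{N+k}{k}\frac{z^k}{k}\equiv \sum_{k=1}^{N}\binom{3k}{k,k,k}\frac{3^{ -3k}z^k}{k}\pmod p,$$ i.e. the coefficients of $z^k$ on both sides are congruent modulo $p$ for each $k$.
   Context: $\binom{3k}{k,k,k}=\frac{(3k)!}{(k!)^3}$. For rational numbers $x,y$ whose denominators are prime to $p$, $x\equiv y \pmod{p}$ means $x-y\in p\mathbb{Z}_{(p)}$. -}

module Defs where

open import Data.Nat as ℕ using (ℕ; suc; NonZero; _!)
open import Data.Nat.Properties using (_!≢0; m^n≢0)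
open import Data.Nat.Combinatorics using (_C_)
open import Data.Integer as ℤ using (ℤ; +_; -1ℤ)
open import Data.Integer.Divisibility as ℤD using ()
open import Data.Rational as ℚ using (ℚ; _/_; _-_; _*_)
open import Data.Product using (Σ; _×_)
open import Relation.Binary.PropositionalEquality using (_≡_)
open import Relation.Nullary using (¬_)

-- x ≡ y (mod p) for rationals: x - y ∈ p ℤ_(p), i.e. x - y = a / b with
-- p ∣ a (in ℤ) and p ∤ b (b a positive natural, written suc b').
_≡_[modℚ_] : ℚ → ℚ → ℕ → Set
x ≡ y [modℚ p ] =
  Σ ℤ λ a → Σ ℕ λ b' →
    ((+ p) ℤD.∣ a) × (¬ (p ℕ.∣ suc b')) × (x - y ≡ a / suc b')
  where open import Data.Nat.Divisibility as ℕ using ()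

multinom3 : ℕ → ℚ
multinom3 k = (+ ((3 ℕ.* k) !)) / ((k !) ℕ.^ 3)
  where instance _ = k !≢0
                 _ = m^n≢0 (k !) 3

lhsCoeff : (N k : ℕ) → .{{NonZero k}} → ℚ
lhsCoeff N k = ((-1ℤ ℤ.^ k) ℤ.* (+ (N C k)) ℤ.* (+ ((N ℕ.+ k) C k))) / k

rhsCoeff : (k : ℕ) → .{{NonZero k}} → ℚ
rhsCoeff k = multinom3 k * ((+ 1) / (3 ℕ.^ (3 ℕ.* k))) * ((+ 1) / k)
  where instance _ = m^n≢0 3 (3 ℕ.* k)

module Submission where

open import Defs
open import Data.Nat using (ℕ; _≤_; _/_; NonZero)
open import Data.Nat.Primality using (Prime)

-- Write p = 3N + r with N = ⌊p/3⌋; since p ≥ 5 is prime, r ∈ {1, 2}.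
-- Multiplying the k-th left coefficient (-1)^k C(N,k) C(N+k,k) / k by the
-- denominator k · (k!)³ · 27^k of the right one, the theorem becomes the
-- integer congruence
--     L(k) := (-1)^k 27^k k! · C(N,k) C(N+k,k) (k!)²  ≡  (3k)!   (mod 3N + r)
-- together with the fact that p divides none of k, k!, 27.
-- Both sides of the congruence satisfy a first-order recurrence in k:
--     L(k+1) = -27 (k+1)(N-k)(N+k+1) · L(k),
--     (3k+3)! = (3k+3)(3k+2)(3k+1) · (3k)!,
-- and the two ratios agree modulo 3N + r exactly because r(3 - r) = 2.
-- The file proves, in order: divisibility facts for a prime (Primes), the
-- product formula and recurrence for C(N,k) C(N+k,k) (k!)² (Combinatorics),
-- the congruence L(k) ≡ (3k)! by induction on k (Congruence), the exact
-- value of lhsCoeff − rhsCoeff as a fraction (Fractions), and finally the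
-- theorem.

open import Data.Nat.Divisibility using (_∣_)
open import Data.Sum using (_⊎_; inj₁; inj₂)
open import Relation.Nullary using (¬_)
open import Relation.Binary.PropositionalEquality
  using (_≡_; refl; sym; trans; cong; cong₂; subst; subst₂; module ≡-Reasoning)

module Primes {p : ℕ} (p-prime : Prime p) where
  open import Data.Nat using (zero; suc; _*_; _^_; _!; _%_; _<_; z<s; s≤s; nonTrivial⇒n>1)
  open import Data.Nat.Properties using (<⇒≱; <⇒≤)
  open import Data.Nat.Divisibility using (∣⇒≤; m%n≡0⇒n∣m)
  open import Data.Nat.DivMod using (m%n<n)
  open import Data.Nat.Primality using (euclidsLemma; prime⇒nonTrivial; prime⇒irreducible)

  ∤-small : ∀ m → 0 < m → m < p → ¬ p ∣ m
  ∤-small (suc m) _ m<p p∣m = <⇒≱ m<p (∣⇒≤ p∣m)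

  ∤-* : ∀ {a b} → ¬ p ∣ a → ¬ p ∣ b → ¬ p ∣ a * b
  ∤-* {a} {b} p∤a p∤b p∣ab with euclidsLemma a b p-prime p∣ab
  ... | inj₁ p∣a = p∤a p∣a
  ... | inj₂ p∣b = p∤b p∣b

  ∤-1 : ¬ p ∣ 1
  ∤-1 = ∤-small 1 z<s (nonTrivial⇒n>1 p {{prime⇒nonTrivial p-prime}})

  ∤-^ : ∀ {a} n → ¬ p ∣ a → ¬ p ∣ a ^ n
  ∤-^ zero    _   = ∤-1
  ∤-^ (suc n) p∤a = ∤-* p∤a (∤-^ n p∤a)

  ∤-! : ∀ m → m < p → ¬ p ∣ m !
  ∤-! zero    _   = ∤-1
  ∤-! (suc m) m<p = ∤-* (∤-small (suc m) z<s m<p) (∤-! m (<⇒≤ m<p))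

  residue : 5 ≤ p → p % 3 ≡ 1 ⊎ p % 3 ≡ 2
  residue 5≤p with p % 3 in eq | m%n<n p 3
  ... | 1 | _ = inj₁ refl
  ... | 2 | _ = inj₂ refl
  ... | suc (suc (suc _)) | s≤s (s≤s (s≤s ()))
  -- remainder 0 would make 3 a divisor of p, forcing p = 3 < 5
  ... | 0 | _ with prime⇒irreducible p-prime (m%n≡0⇒n∣m p 3 eq)
  ...   | inj₁ ()
  ...   | inj₂ refl with 5≤p
  ...     | s≤s (s≤s (s≤s ()))


module Combinatorics where
  open import Data.Nat using (suc; _+_; _*_; _∸_; _!)
  open import Data.Nat.Properties
    using (_!≢0; _!*_!≢0; *-cancelʳ-≡; *-comm; m+n∸n≡m; m≤n+m; <⇒≤; +-suc)
  open import Data.Nat.DivMod using (m/n*n≡m)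
  open import Data.Nat.Combinatorics
    using (_C_; nCk≡n!/k![n-k]!; k![n∸k]!∣n!; [n-k]*[n-k-1]!≡[n-k]!)
  open import Data.Nat.Tactic.RingSolver using (solve-∀)
  open ≡-Reasoning

  binomial-factorial : ∀ {n k} → k ≤ n → (n C k) * (k ! * (n ∸ k) !) ≡ n !
  binomial-factorial {n} {k} k≤n =
    trans (cong (_* (k ! * (n ∸ k) !)) (nCk≡n!/k![n-k]! k≤n)) (m/n*n≡m (k![n∸k]!∣n! k≤n))
    where instance _ = k !* (n ∸ k) !≢0

  centralProduct : ℕ → ℕ → ℕ
  centralProduct N k = (N C k) * ((N + k) C k) * (k ! * k !)

  centralProduct-factorial : ∀ {N k} → k ≤ N → centralProduct N k * (N ∸ k) ! ≡ (N + k) !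
  centralProduct-factorial {N} {k} k≤N = *-cancelʳ-≡ _ _ (N !) {{N !≢0}} (begin
      centralProduct N k * (N ∸ k) ! * N !
    ≡⟨ regroup (N C k) ((N + k) C k) (k !) ((N ∸ k) !) (N !) ⟩
      ((N C k) * (k ! * (N ∸ k) !)) * (((N + k) C k) * (k ! * N !))
    ≡⟨ cong₂ _*_ (binomial-factorial k≤N) upper ⟩
      N ! * (N + k) !
    ≡⟨ *-comm (N !) ((N + k) !) ⟩
      (N + k) ! * N ! ∎)
    where
    regroup : ∀ c d a b e → c * d * (a * a) * b * e ≡ (c * (a * b)) * (d * (a * e))
    regroup = solve-∀
    upper : ((N + k) C k) * (k ! * N !) ≡ (N + k) !
    upper = subst (λ m → ((N + k) C k) * (k ! * m !) ≡ (N + k) !) (m+n∸n≡m N k)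
                  (binomial-factorial (m≤n+m k N))

  -- passing from k to k+1 multiplies (N+k)!/(N-k)! by (N-k)(N+k+1)
  centralProduct-step : ∀ {N k} → suc k ≤ N →
    centralProduct N (suc k) ≡ (N ∸ k) * suc (N + k) * centralProduct N k
  centralProduct-step {N} {k} k<N = *-cancelʳ-≡ _ _ ((N ∸ suc k) !) {{(N ∸ suc k) !≢0}} (begin
      centralProduct N (suc k) * (N ∸ suc k) !
    ≡⟨ centralProduct-factorial k<N ⟩
      (N + suc k) !
    ≡⟨ cong _! (+-suc N k) ⟩
      suc (N + k) * (N + k) !
    ≡⟨ cong (suc (N + k) *_) (centralProduct-factorial (<⇒≤ k<N)) ⟨
      suc (N + k) * (centralProduct N k * (N ∸ k) !)
    ≡⟨ cong (λ m → suc (N + k) * (centralProduct N k * m)) ([n-k]*[n-k-1]!≡[n-k]! k<N) ⟨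
      suc (N + k) * (centralProduct N k * ((N ∸ k) * (N ∸ suc k) !))
    ≡⟨ regroup (suc (N + k)) (centralProduct N k) (N ∸ k) ((N ∸ suc k) !) ⟩
      (N ∸ k) * suc (N + k) * centralProduct N k * (N ∸ suc k) ! ∎)
    where
    regroup : ∀ s c d f → s * (c * (d * f)) ≡ d * s * c * f
    regroup = solve-∀

module Congruence where
  open import Data.Nat as ℕ using (suc; zero; _!)
  open import Data.Nat.Properties using (<⇒≤; *-suc)
  open import Data.Integer using (ℤ; +_; -1ℤ; 1ℤ; 0ℤ; _+_; _-_; _*_; _^_)
  open import Data.Integer.Properties using (pos-*; m-n≡m⊖n; ⊖-≥)
  open import Data.Integer.Divisibility.Signed using (divides; ∣m∣n⇒∣m+n; ∣n⇒∣m*n; ∣m⇒∣m*n)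
    renaming (_∣_ to _∣ℤ_)
  open import Data.Integer.Tactic.RingSolver using (solve-∀)
  open Combinatorics using (centralProduct; centralProduct-step)
  open ≡-Reasoning

  infix 4 _≡_[modℤ_]
  _≡_[modℤ_] : ℤ → ℤ → ℤ → Set
  a ≡ b [modℤ m ] = m ∣ℤ a - b

  *-cong-mod : ∀ {m a b c d} → a ≡ b [modℤ m ] → c ≡ d [modℤ m ] → c * a ≡ d * b [modℤ m ]
  *-cong-mod {m} {a} {b} {c} {d} a≡b c≡d =
    subst (m ∣ℤ_) (split c a d b) (∣m∣n⇒∣m+n (∣n⇒∣m*n c a≡b) (∣m⇒∣m*n b c≡d))
    where
    split : ∀ c a d b → c * (a - b) + (c - d) * b ≡ c * a - d * b
    split = solve-∀

  -- L(k) = (-1)^k 27^k k! · C(N,k) C(N+k,k) (k!)²; it is k (k!)³ 27^k times the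
  -- left coefficient, while (3k)! is the same multiple of the right one
  scaledLeft : ℕ → ℕ → ℤ
  scaledLeft N k = -1ℤ ^ k * (+ 27) ^ k * + (k !) * + centralProduct N k

  -- L(k+1) / L(k) = -27 (k+1)(N-k)(N+k+1)
  leftRatio : ℕ → ℕ → ℤ
  leftRatio N k = -1ℤ * + 27 * (1ℤ + + k) * ((+ N - + k) * (1ℤ + (+ N + + k)))

  -- (3k+3)! / (3k)! = (3k+3)(3k+2)(3k+1)
  rightRatio : ℕ → ℤ
  rightRatio k = (+ 3 + + 3 * + k) * ((+ 2 + + 3 * + k) * (+ 1 + + 3 * + k))

  -- modulo 3N + r the two ratios agree when r(3 - r) = 2, i.e. r ∈ {1,2}:
  -- their difference is -3(k+1)(3N + 3 - r) · (3N + r)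
  ratio-congruence : ∀ {r} → r ≡ 1 ⊎ r ≡ 2 → ∀ N k →
    leftRatio N k ≡ rightRatio k [modℤ + r + + 3 * + N ]
  ratio-congruence (inj₁ refl) N k =
    divides (-1ℤ * + 3 * (1ℤ + + k) * (+ 2 + + 3 * + N)) (factor (+ N) (+ k))
    where
    factor : ∀ N k → -1ℤ * + 27 * (1ℤ + k) * ((N - k) * (1ℤ + (N + k)))
                     - (+ 3 + + 3 * k) * ((+ 2 + + 3 * k) * (+ 1 + + 3 * k))
                   ≡ (-1ℤ * + 3 * (1ℤ + k) * (+ 2 + + 3 * N)) * (+ 1 + + 3 * N)
    factor = solve-∀
  ratio-congruence (inj₂ refl) N k =
    divides (-1ℤ * + 3 * (1ℤ + + k) * (+ 1 + + 3 * + N)) (factor (+ N) (+ k))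
    where
    factor : ∀ N k → -1ℤ * + 27 * (1ℤ + k) * ((N - k) * (1ℤ + (N + k)))
                     - (+ 3 + + 3 * k) * ((+ 2 + + 3 * k) * (+ 1 + + 3 * k))
                   ≡ (-1ℤ * + 3 * (1ℤ + k) * (+ 1 + + 3 * N)) * (+ 2 + + 3 * N)
    factor = solve-∀

  centralProduct-stepℤ : ∀ {N k} → suc k ℕ.≤ N →
    + centralProduct N (suc k) ≡ (+ N - + k) * (1ℤ + (+ N + + k)) * + centralProduct N k
  centralProduct-stepℤ {N} {k} k<N = begin
      + centralProduct N (suc k)
    ≡⟨ cong +_ (centralProduct-step k<N) ⟩
      + ((N ℕ.∸ k) ℕ.* suc (N ℕ.+ k) ℕ.* centralProduct N k)
    ≡⟨ pos-* ((N ℕ.∸ k) ℕ.* suc (N ℕ.+ k)) (centralProduct N k) ⟩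
      + ((N ℕ.∸ k) ℕ.* suc (N ℕ.+ k)) * + centralProduct N k
    ≡⟨ cong (_* + centralProduct N k) (pos-* (N ℕ.∸ k) (suc (N ℕ.+ k))) ⟩
      + (N ℕ.∸ k) * + suc (N ℕ.+ k) * + centralProduct N k
    ≡⟨ cong (λ d → d * + suc (N ℕ.+ k) * + centralProduct N k) difference ⟩
      (+ N - + k) * (1ℤ + (+ N + + k)) * + centralProduct N k ∎
    where
    difference : + (N ℕ.∸ k) ≡ + N - + k
    difference = sym (trans (m-n≡m⊖n N k) (⊖-≥ (<⇒≤ k<N)))

  scaledLeft-step : ∀ {N k} → suc k ℕ.≤ N → scaledLeft N (suc k) ≡ leftRatio N k * scaledLeft N k
  scaledLeft-step {N} {k} k<N = begin
      scaledLeft N (suc k)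
    ≡⟨ cong₂ (λ f c → -1ℤ * -1ℤ ^ k * (+ 27 * (+ 27) ^ k) * f * c)
             (pos-* (suc k) (k !)) (centralProduct-stepℤ k<N) ⟩
      -1ℤ * -1ℤ ^ k * (+ 27 * (+ 27) ^ k) * ((1ℤ + + k) * + (k !))
        * ((+ N - + k) * (1ℤ + (+ N + + k)) * + centralProduct N k)
    ≡⟨ regroup (-1ℤ ^ k) ((+ 27) ^ k) (+ (k !)) (+ centralProduct N k) (+ N) (+ k) ⟩
      leftRatio N k * scaledLeft N k ∎
    where
    regroup : ∀ s t f c N k →
      -1ℤ * s * (+ 27 * t) * ((1ℤ + k) * f) * ((N - k) * (1ℤ + (N + k)) * c)
        ≡ -1ℤ * + 27 * (1ℤ + k) * ((N - k) * (1ℤ + (N + k))) * (s * t * f * c)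
    regroup = solve-∀

  factorial-step : ∀ k → + ((3 ℕ.* suc k) !) ≡ rightRatio k * + ((3 ℕ.* k) !)
  factorial-step k = begin
      + ((3 ℕ.* suc k) !)
    ≡⟨ cong (λ n → + (n !)) (*-suc 3 k) ⟩
      + ((3 ℕ.+ m) ℕ.* ((2 ℕ.+ m) ℕ.* ((1 ℕ.+ m) ℕ.* m !)))
    ≡⟨ pos-*-three (3 ℕ.+ m) (2 ℕ.+ m) (1 ℕ.+ m) (m !) ⟩
      + (3 ℕ.+ m) * (+ (2 ℕ.+ m) * (+ (1 ℕ.+ m) * + (m !)))
    ≡⟨ cong (λ i → (+ 3 + i) * ((+ 2 + i) * ((+ 1 + i) * + (m !)))) (pos-* 3 k) ⟩
      (+ 3 + + 3 * + k) * ((+ 2 + + 3 * + k) * ((+ 1 + + 3 * + k) * + (m !)))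
    ≡⟨ regroup (+ 3 * + k) (+ (m !)) ⟩
      rightRatio k * + (m !) ∎
    where
    m = 3 ℕ.* k
    pos-*-three : ∀ a b c d → + (a ℕ.* (b ℕ.* (c ℕ.* d))) ≡ + a * (+ b * (+ c * + d))
    pos-*-three a b c d =
      trans (pos-* a _) (cong (+ a *_) (trans (pos-* b _) (cong (+ b *_) (pos-* c d))))
    regroup : ∀ i g → (+ 3 + i) * ((+ 2 + i) * ((+ 1 + i) * g))
                    ≡ (+ 3 + i) * ((+ 2 + i) * (+ 1 + i)) * g
    regroup = solve-∀

  key-congruence : ∀ {r} → r ≡ 1 ⊎ r ≡ 2 → ∀ N k → k ℕ.≤ N →
    scaledLeft N k ≡ + ((3 ℕ.* k) !) [modℤ + r + + 3 * + N ]
  key-congruence r∈ N zero    _   = divides 0ℤ refl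
  key-congruence r∈ N (suc k) k<N =
    subst₂ (λ a b → a ≡ b [modℤ _ ]) (sym (scaledLeft-step k<N)) (sym (factorial-step k))
      (*-cong-mod {c = leftRatio N k} {d = rightRatio k}
        (key-congruence r∈ N k (<⇒≤ k<N)) (ratio-congruence r∈ N k))

module Fractions where
  open import Data.Nat as ℕ using (zero; suc; _!)
  open import Data.Nat.Properties using (m*n≢0; m^n≢0; _!≢0; ^-*-assoc)
  open import Data.Integer as ℤ using (+_; -1ℤ)
  open import Data.Integer.Properties using (pos-*; neg-distribˡ-*)
  open import Data.Integer.Divisibility.Signed using (∣⇒∣ᵤ) renaming (_∣_ to _∣ℤ_)
  open import Data.Integer.Tactic.RingSolver using (solve-∀)
  open import Data.Product using (_,_)
  import Data.Rational as ℚ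
  open import Data.Rational.Properties
    using (toℚᵘ-injective; toℚᵘ-fromℚᵘ; toℚᵘ-homo-+; toℚᵘ-homo‿-; toℚᵘ-homo-*; /-cong)
  import Data.Rational.Unnormalised as ℚᵘ
  import Data.Rational.Unnormalised.Properties as ℚᵘ
  open import Data.Nat.Combinatorics using (_C_)
  open Combinatorics using (centralProduct)
  open Congruence using (scaledLeft)

  toℚᵘ-/ : ∀ i n .{{_ : NonZero n}} → ℚ.toℚᵘ (i ℚ./ n) ℚᵘ.≃ (i ℚᵘ./ n)
  toℚᵘ-/ i (suc m) = toℚᵘ-fromℚᵘ (ℚᵘ.mkℚᵘ i m)

  fraction-product : ∀ i m j n .{{_ : NonZero m}} .{{_ : NonZero n}} →
    (i ℚ./ m) ℚ.* (j ℚ./ n) ≡ ((i ℤ.* j) ℚ./ (m ℕ.* n)) {{m*n≢0 m n}}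
  fraction-product i m@(suc _) j n@(suc _) = toℚᵘ-injective (begin
      ℚ.toℚᵘ ((i ℚ./ m) ℚ.* (j ℚ./ n))      ≈⟨ toℚᵘ-homo-* (i ℚ./ m) (j ℚ./ n) ⟩
      ℚ.toℚᵘ (i ℚ./ m) ℚᵘ.* ℚ.toℚᵘ (j ℚ./ n) ≈⟨ ℚᵘ.*-cong (toℚᵘ-/ i m) (toℚᵘ-/ j n) ⟩
      (i ℚᵘ./ m) ℚᵘ.* (j ℚᵘ./ n)            ≈⟨ toℚᵘ-/ (i ℤ.* j) (m ℕ.* n) ⟨
      ℚ.toℚᵘ ((i ℤ.* j) ℚ./ (m ℕ.* n))      ∎)
    where open ℚᵘ.≃-Reasoning

  fraction-difference : ∀ i m j n .{{_ : NonZero m}} .{{_ : NonZero n}} →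
    (i ℚ./ m) ℚ.- (j ℚ./ n) ≡ ((i ℤ.* + n ℤ.- j ℤ.* + m) ℚ./ (m ℕ.* n)) {{m*n≢0 m n}}
  fraction-difference i m@(suc _) j n@(suc _) = toℚᵘ-injective (begin
      ℚ.toℚᵘ ((i ℚ./ m) ℚ.- (j ℚ./ n))
    ≈⟨ toℚᵘ-homo-+ (i ℚ./ m) (ℚ.- (j ℚ./ n)) ⟩
      ℚ.toℚᵘ (i ℚ./ m) ℚᵘ.+ ℚ.toℚᵘ (ℚ.- (j ℚ./ n))
    ≈⟨ ℚᵘ.+-cong (toℚᵘ-/ i m) (ℚᵘ.≃-trans (toℚᵘ-homo‿- (j ℚ./ n)) (ℚᵘ.-‿cong (toℚᵘ-/ j n))) ⟩
      (i ℚᵘ./ m) ℚᵘ.- (j ℚᵘ./ n)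
    ≈⟨ ℚᵘ.*≡* (cong (λ z → (i ℤ.* + n ℤ.+ z) ℤ.* + (m ℕ.* n)) (sym (neg-distribˡ-* j (+ m)))) ⟩
      (i ℤ.* + n ℤ.- j ℤ.* + m) ℚᵘ./ (m ℕ.* n)
    ≈⟨ toℚᵘ-/ (i ℤ.* + n ℤ.- j ℤ.* + m) (m ℕ.* n) ⟨
      ℚ.toℚᵘ ((i ℤ.* + n ℤ.- j ℤ.* + m) ℚ./ (m ℕ.* n)) ∎)
    where open ℚᵘ.≃-Reasoning

  modℚ-intro : ∀ {p} x y a d .{{_ : NonZero d}} →
    + p ∣ℤ a → ¬ p ∣ d → x ℚ.- y ≡ a ℚ./ d → x ≡ y [modℚ p ]
  modℚ-intro _ _ a (suc d) p∣a p∤d eq = a , d , ∣⇒∣ᵤ p∣a , p∤d , eq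

  pos-^ : ∀ a n → + (a ℕ.^ n) ≡ (+ a) ℤ.^ n
  pos-^ a zero    = refl
  pos-^ a (suc n) = trans (pos-* a (a ℕ.^ n)) (cong (+ a ℤ.*_) (pos-^ a n))

  rhsDenominator : ℕ → ℕ
  rhsDenominator k = (k !) ℕ.^ 3 ℕ.* 3 ℕ.^ (3 ℕ.* k) ℕ.* k

  rhsDenominator≢0 : ∀ k .{{_ : NonZero k}} → NonZero (rhsDenominator k)
  rhsDenominator≢0 k = m*n≢0 _ k {{m*n≢0 _ _ {{m^n≢0 (k !) 3 {{k !≢0}}}} {{m^n≢0 3 (3 ℕ.* k)}}}}

  commonDenominator : ℕ → ℕ
  commonDenominator k = k ℕ.* rhsDenominator k

  commonDenominator≢0 : ∀ k .{{_ : NonZero k}} → NonZero (commonDenominator k)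
  commonDenominator≢0 k = m*n≢0 k (rhsDenominator k)
    where instance _ = rhsDenominator≢0 k

  rhsCoeff-fraction : ∀ k .{{_ : NonZero k}} →
    rhsCoeff k ≡ ((+ ((3 ℕ.* k) !) ℤ.* + 1 ℤ.* + 1) ℚ./ rhsDenominator k) {{rhsDenominator≢0 k}}
  rhsCoeff-fraction k =
    trans (cong (ℚ._* (+ 1 ℚ./ k))
                (fraction-product (+ ((3 ℕ.* k) !)) ((k !) ℕ.^ 3) (+ 1) (3 ℕ.^ (3 ℕ.* k))))
          (fraction-product (+ ((3 ℕ.* k) !) ℤ.* + 1) ((k !) ℕ.^ 3 ℕ.* 3 ℕ.^ (3 ℕ.* k)) (+ 1) k)
    where instance _ = m^n≢0 (k !) 3 {{k !≢0}}
                   _ = m^n≢0 3 (3 ℕ.* k)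
                   _ = m*n≢0 ((k !) ℕ.^ 3) (3 ℕ.^ (3 ℕ.* k))

  rhsDenominator-ℤ : ∀ k → + rhsDenominator k ≡ (+ (k !)) ℤ.^ 3 ℤ.* (+ 27) ℤ.^ k ℤ.* + k
  rhsDenominator-ℤ k = begin
      + ((k !) ℕ.^ 3 ℕ.* 3 ℕ.^ (3 ℕ.* k) ℕ.* k)
    ≡⟨ pos-* ((k !) ℕ.^ 3 ℕ.* 3 ℕ.^ (3 ℕ.* k)) k ⟩
      + ((k !) ℕ.^ 3 ℕ.* 3 ℕ.^ (3 ℕ.* k)) ℤ.* + k
    ≡⟨ cong (ℤ._* + k) (pos-* ((k !) ℕ.^ 3) (3 ℕ.^ (3 ℕ.* k))) ⟩
      + ((k !) ℕ.^ 3) ℤ.* + (3 ℕ.^ (3 ℕ.* k)) ℤ.* + k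
    ≡⟨ cong₂ (λ a b → a ℤ.* b ℤ.* + k) (pos-^ (k !) 3) (cong +_ (sym (^-*-assoc 3 3 k))) ⟩
      (+ (k !)) ℤ.^ 3 ℤ.* + (27 ℕ.^ k) ℤ.* + k
    ≡⟨ cong (λ t → (+ (k !)) ℤ.^ 3 ℤ.* t ℤ.* + k) (pos-^ 27 k) ⟩
      (+ (k !)) ℤ.^ 3 ℤ.* (+ 27) ℤ.^ k ℤ.* + k ∎
    where open ≡-Reasoning

  centralProduct-ℤ : ∀ N k →
    + centralProduct N k ≡ + (N C k) ℤ.* + ((N ℕ.+ k) C k) ℤ.* (+ (k !) ℤ.* + (k !))
  centralProduct-ℤ N k = trans (pos-* ((N C k) ℕ.* ((N ℕ.+ k) C k)) (k ! ℕ.* k !))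
                               (cong₂ ℤ._*_ (pos-* (N C k) ((N ℕ.+ k) C k)) (pos-* (k !) (k !)))

  coefficient-difference : ∀ N k .{{_ : NonZero k}} →
    lhsCoeff N k ℚ.- rhsCoeff k
      ≡ ((+ k ℤ.* (scaledLeft N k ℤ.- + ((3 ℕ.* k) !))) ℚ./ commonDenominator k)
          {{commonDenominator≢0 k}}
  coefficient-difference N k = begin
      lhsCoeff N k ℚ.- rhsCoeff k
    ≡⟨ cong (λ r → lhsCoeff N k ℚ.- r) (rhsCoeff-fraction k) ⟩
      (s ℚ./ k) ℚ.- (g ℚ./ rhsDenominator k)
    ≡⟨ fraction-difference s k g (rhsDenominator k) ⟩
      (s ℤ.* + rhsDenominator k ℤ.- g ℤ.* + k) ℚ./ commonDenominator k
    ≡⟨ /-cong numerator refl ⟩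
      (+ k ℤ.* (scaledLeft N k ℤ.- + ((3 ℕ.* k) !))) ℚ./ commonDenominator k ∎
    where
    open ≡-Reasoning
    instance _ = rhsDenominator≢0 k
             _ = commonDenominator≢0 k
    s = -1ℤ ℤ.^ k ℤ.* + (N C k) ℤ.* + ((N ℕ.+ k) C k)
    g = + ((3 ℕ.* k) !) ℤ.* + 1 ℤ.* + 1
    regroup : ∀ σ c₁ c₂ f t κ γ →
      σ ℤ.* c₁ ℤ.* c₂ ℤ.* (f ℤ.* (f ℤ.* (f ℤ.* + 1)) ℤ.* t ℤ.* κ) ℤ.- γ ℤ.* + 1 ℤ.* + 1 ℤ.* κ
        ≡ κ ℤ.* (σ ℤ.* t ℤ.* f ℤ.* (c₁ ℤ.* c₂ ℤ.* (f ℤ.* f)) ℤ.- γ)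
    regroup = solve-∀
    numerator : s ℤ.* + rhsDenominator k ℤ.- g ℤ.* + k
              ≡ + k ℤ.* (scaledLeft N k ℤ.- + ((3 ℕ.* k) !))
    numerator = begin
        s ℤ.* + rhsDenominator k ℤ.- g ℤ.* + k
      ≡⟨ cong (λ d → s ℤ.* d ℤ.- g ℤ.* + k) (rhsDenominator-ℤ k) ⟩
        s ℤ.* ((+ (k !)) ℤ.^ 3 ℤ.* (+ 27) ℤ.^ k ℤ.* + k) ℤ.- g ℤ.* + k
      ≡⟨ regroup (-1ℤ ℤ.^ k) (+ (N C k)) (+ ((N ℕ.+ k) C k)) (+ (k !)) ((+ 27) ℤ.^ k) (+ k)
                 (+ ((3 ℕ.* k) !)) ⟩
        + k ℤ.* (-1ℤ ℤ.^ k ℤ.* (+ 27) ℤ.^ k ℤ.* + (k !)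
                   ℤ.* (+ (N C k) ℤ.* + ((N ℕ.+ k) C k) ℤ.* (+ (k !) ℤ.* + (k !)))
                 ℤ.- + ((3 ℕ.* k) !))
      ≡⟨ cong (λ c → + k ℤ.* (-1ℤ ℤ.^ k ℤ.* (+ 27) ℤ.^ k ℤ.* + (k !) ℤ.* c ℤ.- + ((3 ℕ.* k) !)))
              (centralProduct-ℤ N k) ⟨
        + k ℤ.* (scaledLeft N k ℤ.- + ((3 ℕ.* k) !)) ∎

open import Data.Nat using (_*_; _!; _%_; _<_; z<s; s≤s; >-nonZero⁻¹)
open import Data.Nat.DivMod using (m≡m%n+[m/n]*n; m/n<m)
open import Data.Nat.Properties using (≤-<-trans; ≤-trans)
open import Data.Nat.Primality using (prime⇒nonZero)
open import Data.Integer as ℤ using (+_)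
open import Data.Integer.Properties using (pos-*; *-comm)
open import Data.Integer.Divisibility.Signed using (∣n⇒∣m*n) renaming (_∣_ to _∣ℤ_)
open Congruence using (scaledLeft; key-congruence)
open Fractions using (commonDenominator; commonDenominator≢0; modℚ-intro; coefficient-difference)

lemma2p6 : (p : ℕ) → Prime p → 5 ≤ p →
    (k : ℕ) → .{{_ : NonZero k}} → k ≤ p / 3 →
    lhsCoeff (p / 3) k ≡ rhsCoeff k [modℚ p ]
lemma2p6 p p-prime 5≤p k k≤N =
  modℚ-intro (lhsCoeff N k) (rhsCoeff k) _ (commonDenominator k)
    p∣numerator p∤denominator (coefficient-difference N k)
  where
  open Primes p-prime
  instance _ = prime⇒nonZero p-prime
           _ = commonDenominator≢0 k
  N = p / 3
  modulus : + (p % 3) ℤ.+ + 3 ℤ.* + N ≡ + p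
  modulus = sym (trans (cong +_ (m≡m%n+[m/n]*n p 3))
                       (cong (λ m → + (p % 3) ℤ.+ m) (trans (pos-* N 3) (*-comm (+ N) (+ 3)))))
  p∣numerator : + p ∣ℤ + k ℤ.* (scaledLeft N k ℤ.- + ((3 * k) !))
  p∣numerator = ∣n⇒∣m*n (+ k)
    (subst (_∣ℤ scaledLeft N k ℤ.- + ((3 * k) !)) modulus (key-congruence (residue 5≤p) N k k≤N))
  k<p : k < p
  k<p = ≤-<-trans k≤N (m/n<m p 3 (s≤s z<s))
  p∤k : ¬ p ∣ k
  p∤k = ∤-small k (>-nonZero⁻¹ k) k<p
  p∤3 : ¬ p ∣ 3
  p∤3 = ∤-small 3 z<s (≤-trans (s≤s (s≤s (s≤s z<s))) 5≤p)
  p∤denominator : ¬ p ∣ commonDenominator k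
  p∤denominator = ∤-* p∤k (∤-* (∤-* (∤-^ 3 (∤-! k k<p)) (∤-^ (3 * k) p∤3)) p∤k)
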